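{- Let $p_1$ and $p_2$ be distinct prime numbers congruent to $1\pmod 4$, and let $\varepsilon_2=x+y\sqrt{p_1p_2}$ be the fundamental unit of $\mathbb{Q}(\sqrt{p_1p_2})$, with $x,y$ integers or half-integers. If $\varepsilon_2$ has norm $1$, then neither $x+1$ nor $x-1$ is a square in $\mathbb{N}$. -}

module Defs where

open import Data.Nat as ℕ using (ℕ; _+_; _*_; _%_; _≡ᵇ_)
open import Data.Nat.Primality using (Prime)
open import Data.Integer as ℤ using (ℤ; +_; _-_; 0ℤ)
open import Data.Product using (_×_; Σ; ∃)
open import Data.Sum using (_⊎_)
open import Relation.Binary.PropositionalEquality using (_≡_; _≢_)

-- Elements of the ring of integers of Q(√d) (d squarefree, d ≡ 1 mod 4) are
-- written (a + b√d)/2 with a ≡ b (mod 2).  Here x = a/2, y = b/2.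

-- LeSqrt d u v  :  u ≤ v·√d  (as real numbers), for u v : ℤ, d : ℕ
LeSqrt : ℕ → ℤ → ℤ → Set
LeSqrt d u v =
    (u ℤ.≤ 0ℤ × 0ℤ ℤ.≤ v)
  ⊎ (u ℤ.≤ 0ℤ × v ℤ.< 0ℤ × (+ d) ℤ.* (v ℤ.* v) ℤ.≤ u ℤ.* u)
  ⊎ (0ℤ ℤ.< u × 0ℤ ℤ.< v × u ℤ.* u ℤ.≤ (+ d) ℤ.* (v ℤ.* v))

-- (a + b√d)/2 ≤ (a' + b'√d)/2  as real numbers
LeQ : ℕ → ℕ → ℕ → ℕ → ℕ → Set
LeQ d a b a' b' = LeSqrt d (+ a - + a') (+ b' - + b)

-- (a + b√d)/2 is a unit of the ring of integers of Q(√d) which is > 1.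
-- (Units ε > 1 are exactly those with a, b > 0; norm is (a² - d b²)/4 = ±1.)
IsUnitGt1 : ℕ → ℕ → ℕ → Set
IsUnitGt1 d a b =
    1 ℕ.≤ a × 1 ℕ.≤ b × a % 2 ≡ b % 2
  × (a * a ≡ d * (b * b) + 4 ⊎ a * a + 4 ≡ d * (b * b))

IsFundamentalUnit : ℕ → ℕ → ℕ → Set
IsFundamentalUnit d a b =
  IsUnitGt1 d a b × (∀ a' b' → IsUnitGt1 d a' b' → LeQ d a b a' b')

HasNormOne : ℕ → ℕ → ℕ → Set
HasNormOne d a b = a * a ≡ d * (b * b) + 4

{-# OPTIONS --safe #-}
-- Norm one gives (a - 2)(a + 2) = d b², where a = 2x.  If x + 1 = n² then
-- d b² = (2n)²(n² - 2), and if x - 1 = m² then d b² = (2m)²(m² + 2).  As d is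
-- squarefree, the cofactor (n² - 2, resp. m² + 2) is d t², which is 0 or 1
-- mod 4 because d ≡ 1 (mod 4); but no two numbers that are 0 or 1 mod 4 differ by 2.
module Submission where

open import Defs
open import Data.Nat using (ℕ; suc; _+_; _*_; _%_; _/_; _≤_; _<_; z≤n; s≤s; NonZero; nonTrivial⇒≢1; ≢-nonZero; ≢-nonZero⁻¹; >-nonZero)
open import Data.Nat.Properties
open import Data.Nat.DivMod using (%-distribˡ-*; %-distribˡ-+; m%n<n; m%n%n≡m%n; m<n⇒m%n≡m; m/n*n≡m)
open import Data.Nat.Divisibility using (_∣_; divides; quotient; ∣-trans; m∣m*n; *-pres-∣; *-cancelʳ-∣)
open import Data.Nat.GCD using (gcd; gcd[m,n]∣m; gcd[m,n]∣n; gcd[m,n]≢0)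
open import Data.Nat.Coprimality as Coprimality using (Coprime; coprime-/gcd; coprime-divisor; gcd≡1⇒coprime)
open import Data.Nat.Primality using (Prime; prime⇒irreducible; prime⇒nonZero; prime⇒nonTrivial)
open import Data.Nat.Tactic.RingSolver using (solve-∀)
open import Algebra.Properties.CommutativeSemigroup *-commutativeSemigroup using (xy∙z≈xz∙y)
open import Data.Product using (∃; _×_; _,_)
open import Data.Sum using (inj₁; inj₂)
open import Data.Empty using (⊥-elim)
open import Relation.Nullary using (¬_)
open import Function using (_∘_)
open import Relation.Binary.PropositionalEquality

square%4≤1 : ∀ n → n * n % 4 ≤ 1
square%4≤1 n = subst (_≤ 1) (sym (%-distribˡ-* n n 4)) (residue² (n % 4) (m%n<n n 4))
  where
  residue² : ∀ r → r < 4 → r * r % 4 ≤ 1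
  residue² 0 _ = z≤n
  residue² 1 _ = ≤-refl
  residue² 2 _ = z≤n
  residue² 3 _ = ≤-refl
  residue² (suc (suc (suc (suc _)))) (s≤s (s≤s (s≤s (s≤s ()))))

*-square%4≤1 : ∀ d t → d % 4 ≡ 1 → d * (t * t) % 4 ≤ 1
*-square%4≤1 d t d≡1 = begin
  d * (t * t) % 4              ≡⟨ %-distribˡ-* d (t * t) 4 ⟩
  d % 4 * (t * t % 4) % 4      ≡⟨ cong (λ r → r * (t * t % 4) % 4) d≡1 ⟩
  (t * t % 4 + 0) % 4          ≡⟨ cong (_% 4) (+-identityʳ (t * t % 4)) ⟩
  t * t % 4 % 4                ≡⟨ m%n%n≡m%n (t * t) 4 ⟩
  t * t % 4                    ≤⟨ square%4≤1 t ⟩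
  1                            ∎
  where open ≤-Reasoning

%4≤1⇒+2%4≥2 : ∀ v → v % 4 ≤ 1 → 2 ≤ (v + 2) % 4
%4≤1⇒+2%4≥2 v v≤1 = begin
  2                     ≤⟨ m≤n+m 2 (v % 4) ⟩
  v % 4 + 2             ≡⟨ sym (m<n⇒m%n≡m (+-monoˡ-< 2 (s≤s v≤1))) ⟩
  (v % 4 + 2) % 4       ≡⟨ sym (%-distribˡ-+ v 2 4) ⟩
  (v + 2) % 4           ∎
  where open ≤-Reasoning

%4≤1⇒≢+2 : ∀ u v → u % 4 ≤ 1 → v % 4 ≤ 1 → u ≢ v + 2
%4≤1⇒≢+2 u v u≤1 v≤1 refl = <⇒≱ (s≤s u≤1) (%4≤1⇒+2%4≥2 v v≤1)

SquareFree : ℕ → Set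
SquareFree d = ∀ γ → γ * γ ∣ d → γ ≡ 1

prime²∤prime* : ∀ {p q} → Prime p → Prime q → p ≢ q → ¬ (p * p ∣ q * p)
prime²∤prime* {p} pp pq p≢q p²∣qp with prime⇒irreducible pq (*-cancelʳ-∣ p {{prime⇒nonZero pp}} p²∣qp)
... | inj₁ p≡1 = nonTrivial⇒≢1 {{prime⇒nonTrivial pp}} p≡1
... | inj₂ p≡q = p≢q p≡q

prime*prime-squareFree : ∀ {p q} → Prime p → Prime q → p ≢ q → SquareFree (p * q)
prime*prime-squareFree {p} {q} pp pq p≢q γ γ²∣pq with prime⇒irreducible pp (gcd[m,n]∣n γ p)
... | inj₁ gcd≡1 with prime⇒irreducible pq (coprime-divisor (gcd≡1⇒coprime gcd≡1) (∣-trans (m∣m*n γ) γ²∣pq))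
...   | inj₁ γ≡1 = γ≡1
...   | inj₂ refl = ⊥-elim (prime²∤prime* pq pp (p≢q ∘ sym) γ²∣pq)
prime*prime-squareFree {p} {q} pp pq p≢q γ γ²∣pq | inj₂ gcd≡p =
  ⊥-elim (prime²∤prime* pp pq p≢q (subst (p * p ∣_) (*-comm p q) (∣-trans (*-pres-∣ p∣γ p∣γ) γ²∣pq)))
  where
  p∣γ : p ∣ γ
  p∣γ = subst (_∣ γ) gcd≡p (gcd[m,n]∣m γ p)

coprime-divisor² : ∀ {γ β x} → Coprime γ β → γ ∣ β * β * x → γ ∣ x
coprime-divisor² {γ} {β} {x} γ⊥β = coprime-divisor γ⊥β ∘ coprime-divisor γ⊥β ∘ subst (γ ∣_) (*-assoc β β x)

squareFree∧coprime⇒denominator≡1 : ∀ {d β γ k} .{{_ : NonZero γ}} → SquareFree d → Coprime γ β →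
                                   d * (β * β) ≡ γ * γ * k → γ ≡ 1
squareFree∧coprime⇒denominator≡1 {d} {β} {γ} {k} sqf γ⊥β dβ²≡γ²k = sqf γ γ²∣d
  where
  open ≡-Reasoning
  dβ²≡γkγ : d * (β * β) ≡ γ * k * γ
  dβ²≡γkγ = trans dβ²≡γ²k (xy∙z≈xz∙y γ γ k)
  γ∣d : γ ∣ d
  γ∣d = coprime-divisor² γ⊥β (divides (γ * k) (trans (*-comm (β * β) d) dβ²≡γkγ))
  e : ℕ
  e = quotient γ∣d
  d≡eγ : d ≡ e * γ
  d≡eγ = _∣_.equality γ∣d
  eβ²≡γk : e * (β * β) ≡ γ * k
  eβ²≡γk = *-cancelʳ-≡ _ _ γ (begin
    e * (β * β) * γ   ≡⟨ xy∙z≈xz∙y e (β * β) γ ⟩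
    e * γ * (β * β)   ≡⟨ cong (_* (β * β)) d≡eγ ⟨
    d * (β * β)       ≡⟨ dβ²≡γkγ ⟩
    γ * k * γ         ∎)
  γ∣e : γ ∣ e
  γ∣e = coprime-divisor² γ⊥β (divides k (begin
    β * β * e         ≡⟨ *-comm (β * β) e ⟩
    e * (β * β)       ≡⟨ eβ²≡γk ⟩
    γ * k             ≡⟨ *-comm γ k ⟩
    k * γ             ∎))
  γ²∣d : γ * γ ∣ d
  γ²∣d = divides (quotient γ∣e) (begin
    d                          ≡⟨ d≡eγ ⟩
    e * γ                      ≡⟨ cong (_* γ) (_∣_.equality γ∣e) ⟩
    quotient γ∣e * γ * γ       ≡⟨ *-assoc (quotient γ∣e) γ γ ⟩
    quotient γ∣e * (γ * γ)     ∎)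

-- Write b = βg and c = γg with g = gcd b c; cancelling g² leaves the coprime case.
squareFree-cofactor : ∀ {d} → SquareFree d → ∀ b c k .{{_ : NonZero c}} →
                      d * (b * b) ≡ c * c * k → ∃ λ t → k ≡ d * (t * t)
squareFree-cofactor {d} sqf b c k db²≡c²k = β , sym (begin
  d * (β * β)     ≡⟨ dβ²≡γ²k ⟩
  γ * γ * k       ≡⟨ cong (λ r → r * r * k) γ≡1 ⟩
  k + 0           ≡⟨ +-identityʳ k ⟩
  k               ∎)
  where
  open ≡-Reasoning
  g : ℕ
  g = gcd b c
  instance
    g≢0 : NonZero g
    g≢0 = ≢-nonZero (gcd[m,n]≢0 b c (inj₂ (≢-nonZero⁻¹ c)))
  β γ : ℕ
  β = b / g
  γ = c / g
  βg≡b : β * g ≡ b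
  βg≡b = m/n*n≡m (gcd[m,n]∣m b c)
  γg≡c : γ * g ≡ c
  γg≡c = m/n*n≡m (gcd[m,n]∣n b c)
  instance
    γ≢0 : NonZero γ
    γ≢0 = ≢-nonZero λ γ≡0 → ≢-nonZero⁻¹ c (trans (sym γg≡c) (cong (_* g) γ≡0))
  dβ²≡γ²k : d * (β * β) ≡ γ * γ * k
  dβ²≡γ²k = *-cancelʳ-≡ _ _ (g * g) {{m*n≢0 g g}} (begin
    d * (β * β) * (g * g)         ≡⟨ *-assoc d (β * β) (g * g) ⟩
    d * ((β * β) * (g * g))       ≡⟨ cong (d *_) ([m*n]*[o*p]≡[m*o]*[n*p] β β g g) ⟩
    d * ((β * g) * (β * g))       ≡⟨ cong (λ r → d * (r * r)) βg≡b ⟩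
    d * (b * b)                   ≡⟨ db²≡c²k ⟩
    c * c * k                     ≡⟨ cong (λ r → r * r * k) γg≡c ⟨
    (γ * g) * (γ * g) * k         ≡⟨ cong (_* k) ([m*n]*[o*p]≡[m*o]*[n*p] γ g γ g) ⟩
    (γ * γ) * (g * g) * k         ≡⟨ xy∙z≈xz∙y (γ * γ) (g * g) k ⟩
    γ * γ * k * (g * g)           ∎)
  γ≡1 : γ ≡ 1
  γ≡1 = squareFree∧coprime⇒denominator≡1 sqf (Coprimality.sym (coprime-/gcd b c)) dβ²≡γ²k

squareFree-cofactor%4≤1 : ∀ {d} → SquareFree d → d % 4 ≡ 1 → ∀ b c k .{{_ : NonZero c}} →
                          d * (b * b) ≡ c * c * k → k % 4 ≤ 1
squareFree-cofactor%4≤1 {d} sqf d≡1 b c k db²≡c²k =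
  let t , k≡dt² = squareFree-cofactor sqf b c k db²≡c²k
  in subst (λ r → r % 4 ≤ 1) (sym k≡dt²) (*-square%4≤1 d t d≡1)

a≡2M+2∧a²≡X+4⇒X≡4M[M+2] : ∀ {a X} M → a ≡ 2 * M + 2 → a * a ≡ X + 4 → X ≡ 4 * M * (M + 2)
a≡2M+2∧a²≡X+4⇒X≡4M[M+2] {X = X} M refl a²≡X+4 = +-cancelʳ-≡ 4 X _ (trans (sym a²≡X+4) (expand M))
  where
  expand : ∀ M → (2 * M + 2) * (2 * M + 2) ≡ 4 * M * (M + 2) + 4
  expand = solve-∀

norm-one⇒a+2≢2n² : ∀ {d a b} → SquareFree d → d % 4 ≡ 1 → 1 ≤ a → a * a ≡ d * (b * b) + 4 →
                    ∀ n → a + 2 ≢ 2 * (n * n)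
norm-one⇒a+2≢2n² {a = a} _ _ _ _ 0 a+2≡0 = m+1+n≢0 a a+2≡0
norm-one⇒a+2≢2n² {a = a} _ _ 1≤a _ 1 a+2≡2 = <⇒≢ 1≤a (sym (+-cancelʳ-≡ 2 a 0 a+2≡2))
norm-one⇒a+2≢2n² {d} {a} {b} sqf d≡1 _ norm n@(suc (suc j)) a+2≡2n² =
  %4≤1⇒≢+2 (n * n) M (square%4≤1 n) (squareFree-cofactor%4≤1 sqf d≡1 b (2 * n) M db²≡[2n]²M) n²≡M+2
  where
  open ≡-Reasoning
  M : ℕ
  M = j * j + 4 * j + 2
  n²≡M+2 : n * n ≡ M + 2
  n²≡M+2 = expand j
    where
    expand : ∀ j → (2 + j) * (2 + j) ≡ j * j + 4 * j + 2 + 2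
    expand = solve-∀
  a≡2M+2 : a ≡ 2 * M + 2
  a≡2M+2 = +-cancelʳ-≡ 2 a (2 * M + 2) (begin
    a + 2             ≡⟨ a+2≡2n² ⟩
    2 * (n * n)       ≡⟨ cong (2 *_) n²≡M+2 ⟩
    2 * (M + 2)       ≡⟨ *-distribˡ-+ 2 M 2 ⟩
    2 * M + 4         ≡⟨ +-assoc (2 * M) 2 2 ⟨
    2 * M + 2 + 2     ∎)
  db²≡[2n]²M : d * (b * b) ≡ 2 * n * (2 * n) * M
  db²≡[2n]²M = begin
    d * (b * b)           ≡⟨ a≡2M+2∧a²≡X+4⇒X≡4M[M+2] M a≡2M+2 norm ⟩
    4 * M * (M + 2)       ≡⟨ cong (4 * M *_) n²≡M+2 ⟨
    4 * M * (n * n)       ≡⟨ regroup M n ⟩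
    2 * n * (2 * n) * M   ∎
    where
    regroup : ∀ M n → 4 * M * (n * n) ≡ 2 * n * (2 * n) * M
    regroup = solve-∀

norm-one⇒a≢2m²+2 : ∀ {d a b} → SquareFree d → d % 4 ≡ 1 → 1 ≤ b → a * a ≡ d * (b * b) + 4 →
                    ∀ m → a ≢ 2 * (m * m) + 2
norm-one⇒a≢2m²+2 {d} {b = b} _ d≡1 1≤b norm 0 a≡2 =
  ≢-nonZero⁻¹ (d * (b * b)) (a≡2M+2∧a²≡X+4⇒X≡4M[M+2] 0 a≡2 norm)
  where
  instance
    d≢0 : NonZero d
    d≢0 = ≢-nonZero λ { refl → 0≢1+n d≡1 }
    b≢0 : NonZero b
    b≢0 = >-nonZero 1≤b
    db²≢0 : NonZero (d * (b * b))
    db²≢0 = m*n≢0 d (b * b) {{d≢0}} {{m*n≢0 b b}}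
norm-one⇒a≢2m²+2 {d} {b = b} sqf d≡1 _ norm m@(suc _) a≡2m²+2 =
  %4≤1⇒≢+2 (m * m + 2) (m * m) (squareFree-cofactor%4≤1 sqf d≡1 b (2 * m) (m * m + 2) db²≡[2m]²[m²+2])
           (square%4≤1 m) refl
  where
  db²≡[2m]²[m²+2] : d * (b * b) ≡ 2 * m * (2 * m) * (m * m + 2)
  db²≡[2m]²[m²+2] = trans (a≡2M+2∧a²≡X+4⇒X≡4M[M+2] (m * m) a≡2m²+2 norm) (regroup m)
    where
    regroup : ∀ m → 4 * (m * m) * (m * m + 2) ≡ 2 * m * (2 * m) * (m * m + 2)
    regroup = solve-∀

mainTheorem7 : (p₁ p₂ : ℕ) → Prime p₁ → Prime p₂ → p₁ ≢ p₂ → p₁ % 4 ≡ 1 → p₂ % 4 ≡ 1 →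
    (a b : ℕ) → IsFundamentalUnit (p₁ * p₂) a b → HasNormOne (p₁ * p₂) a b →
    (¬ (∃ λ n → a + 2 ≡ 2 * (n * n))) × (¬ (∃ λ m → a ≡ 2 * (m * m) + 2))
mainTheorem7 p₁ p₂ pp₁ pp₂ p₁≢p₂ p₁≡1 p₂≡1 a b ((1≤a , 1≤b , _) , _) norm =
  (λ (n , eq) → norm-one⇒a+2≢2n² {b = b} sqf d≡1 1≤a norm n eq) ,
  (λ (m , eq) → norm-one⇒a≢2m²+2 {b = b} sqf d≡1 1≤b norm m eq)
  where
  sqf : SquareFree (p₁ * p₂)
  sqf = prime*prime-squareFree pp₁ pp₂ p₁≢p₂
  d≡1 : p₁ * p₂ % 4 ≡ 1
  d≡1 = trans (%-distribˡ-* p₁ p₂ 4) (cong₂ (λ r s → r * s % 4) p₁≡1 p₂≡1)
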